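{- Let $t,\ell$ be positive integers and let $p_1,\dots,p_j$ be all the distinct prime divisors $p$ of $t$ with $p\le 2^\ell$. Then $W(t)\le c_\ell(t)\,t^{1/\ell}$, where $$c_\ell(t)=\frac{2^j}{(p_1\cdots p_j)^{1/\ell}}.$$ In particular, $c_4(t)<4.87$ for every $t$, and $c_4(t)<2.9$ if $t$ is odd. Further, $c_6(t)<46.103$ for every $t$.
   Context: $W(t)=2^{\nu(t)}$, where $\nu(t)$ is the number of distinct prime divisors of $t$ (the number of square-free divisors of $t$). -}

module Defs where

open import Data.Nat using (ℕ; suc; _*_; _^_; _≤_; _<_; _≤?_)
open import Data.Nat.Divisibility using (_∣_; _∣?_)
open import Data.Nat.Primality using (Prime; prime?)
open import Data.List using (List; filter; upTo; length)
open import Data.Nat.ListAction using (product)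
open import Data.Product using (_×_)
open import Relation.Nullary.Decidable using (_×-dec_)

-- The distinct prime divisors of t (for t ≥ 1 they all lie in [0, t]).
primeDivisors : ℕ → List ℕ
primeDivisors t = filter (λ p → prime? p ×-dec p ∣? t) (upTo (suc t))

ν : ℕ → ℕ
ν t = length (primeDivisors t)

W : ℕ → ℕ
W t = 2 ^ ν t

smallPrimeDivisors : ℕ → ℕ → List ℕ
smallPrimeDivisors ℓ t = filter (λ p → p ≤? 2 ^ ℓ) (primeDivisors t)

jSmall : ℕ → ℕ → ℕ
jSmall ℓ t = length (smallPrimeDivisors ℓ t)

PSmall : ℕ → ℕ → ℕ
PSmall ℓ t = product (smallPrimeDivisors ℓ t)

-- c_ℓ(t)^ℓ = 2^(jℓ) / (p₁⋯p_j).
-- "W(t) ≤ c_ℓ(t) t^(1/ℓ)" ⇔ (raising the positive sides to the ℓ-th power,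
-- clearing the positive denominator) W(t)^ℓ · (p₁⋯p_j) ≤ 2^(jℓ) · t.
WBound : ℕ → ℕ → Set
WBound ℓ t = W t ^ ℓ * PSmall ℓ t ≤ 2 ^ (jSmall ℓ t * ℓ) * t

-- "c_ℓ(t) < num/den" (num, den > 0) ⇔ c_ℓ(t)^ℓ < (num/den)^ℓ
-- ⇔ den^ℓ · 2^(jℓ) < num^ℓ · (p₁⋯p_j).
cLt : ℕ → ℕ → ℕ → ℕ → Set
cLt ℓ t num den = den ^ ℓ * 2 ^ (jSmall ℓ t * ℓ) < num ^ ℓ * PSmall ℓ t

-- Every prime divisor p > 2^ℓ of t contributes at least 2^ℓ to t, which pays for its factor 2^ℓ
-- in W(t)^ℓ; the primes p ≤ 2^ℓ are paid for by the factor 2^ℓ/p in c_ℓ(t)^ℓ.  Hence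
-- W(t)^ℓ · p₁⋯p_j ≤ 2^(jℓ) · ∏_{p ∣ t} p ≤ 2^(jℓ) · t.  For the numerical bounds, 2^(jℓ)/(p₁⋯p_j)
-- only grows when further primes p ≤ 2^ℓ are added, so it is largest when p₁,…,p_j are all the
-- (odd) primes up to 2^ℓ, and that single case is decided by computation.
module Submission where

open import Defs
open import Data.Nat using (ℕ; _<_)
open import Data.Nat.Divisibility using (_∣_)
open import Data.Product using (_×_)
open import Relation.Nullary using (¬_)

open import Data.Nat.Base using (suc; _*_; _^_; _≤_; s≤s; NonZero; >-nonZero)
open import Data.Nat.Properties
open import Algebra.Properties.CommutativeSemigroup *-commutativeSemigroup
  using (interchange; x∙yz≈y∙xz; xy∙z≈xz∙y)
open import Data.Nat.Divisibility using (_∣?_; divides; ∣⇒≤; ∣-trans; 1∣_; *-monoˡ-∣)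
open import Data.Nat.Primality using (Prime; prime?; euclidsLemma; productOfPrimes≢0)
open import Data.Nat.Primality.Factorisation using (factorisationHasAllPrimeFactors)
open import Data.Nat.ListAction using (product)
open import Data.List using (List; []; _∷_; filter; length; upTo)
open import Data.List.Properties using (filter-accept; filter-reject)
open import Data.List.Membership.Propositional using (_∈_)
open import Data.List.Membership.Propositional.Properties using (∈-filter⁺; ∈-filter⁻; ∈-upTo⁺; ∈-upTo⁻)
open import Data.List.Relation.Unary.Any using (here; there)
open import Data.List.Relation.Unary.All as All using (All; []; _∷_)
open import Data.List.Relation.Unary.AllPairs using (AllPairs; []; _∷_)
import Data.List.Relation.Unary.AllPairs.Properties as AllPairs
open import Data.List.Relation.Binary.Sublist.Propositional using (_⊆_; []; _∷_; _∷ʳ_; minimum)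
open import Data.Product using (_,_; proj₁; proj₂)
open import Data.Sum using (inj₁; inj₂)
open import Data.Empty using (⊥-elim)
open import Relation.Nullary using (yes; no; ¬?)
open import Relation.Nullary.Decidable using (toWitness; _×-dec_)
open import Relation.Unary using (Pred; Decidable)
open import Relation.Binary.PropositionalEquality using (_≡_; refl; sym; trans; cong; subst)
open import Function using (_∘_)

m^[n*o]≡[m^o]^n : ∀ m n o → m ^ (n * o) ≡ (m ^ o) ^ n
m^[n*o]≡[m^o]^n m n o = subst (λ k → m ^ k ≡ (m ^ o) ^ n) (*-comm o n) (sym (^-*-assoc m o n))

interchange-mono-≤ : ∀ u v {a b c d} → a * b ≤ c * d → u * a * (v * b) ≤ u * c * (v * d)
interchange-mono-≤ u v {a} {b} {c} {d} ab≤cd = begin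
  u * a * (v * b) ≡⟨ interchange u a v b ⟩
  u * v * (a * b) ≤⟨ *-monoʳ-≤ (u * v) ab≤cd ⟩
  u * v * (c * d) ≡⟨ interchange u v c d ⟩
  u * c * (v * d) ∎
  where open ≤-Reasoning

^length*product-⊆ : ∀ {B xs ys} → xs ⊆ ys → All (_≤ B) ys →
                    B ^ length xs * product ys ≤ B ^ length ys * product xs
^length*product-⊆ [] [] = ≤-refl
^length*product-⊆ {B} {xs} {_ ∷ ys} (y ∷ʳ xs⊆ys) (y≤B ∷ ys≤B) = begin
  B ^ length xs * (y * product ys) ≡⟨ x∙yz≈y∙xz (B ^ length xs) y (product ys) ⟩
  y * (B ^ length xs * product ys) ≤⟨ *-mono-≤ y≤B (^length*product-⊆ xs⊆ys ys≤B) ⟩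
  B * (B ^ length ys * product xs) ≡⟨ *-assoc B _ _ ⟨
  B * B ^ length ys * product xs   ∎
  where open ≤-Reasoning
^length*product-⊆ {B} {x ∷ _} (refl ∷ xs⊆ys) (_ ∷ ys≤B) =
  interchange-mono-≤ B x (^length*product-⊆ xs⊆ys ys≤B)

^length*product-⊆-< : ∀ {B a c xs ys} → xs ⊆ ys → All (_≤ B) ys → .{{NonZero (product xs)}} →
                      a * B ^ length ys < c * product ys → a * B ^ length xs < c * product xs
^length*product-⊆-< {B} {a} {c} {xs} {ys} xs⊆ys ys≤B hyp = *-cancelʳ-< (product ys) _ _ (begin-strict
  a * B ^ length xs * product ys   ≡⟨ *-assoc a _ _ ⟩
  a * (B ^ length xs * product ys) ≤⟨ *-monoʳ-≤ a (^length*product-⊆ xs⊆ys ys≤B) ⟩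
  a * (B ^ length ys * product xs) ≡⟨ *-assoc a _ _ ⟨
  a * B ^ length ys * product xs   <⟨ *-monoˡ-< (product xs) hyp ⟩
  c * product ys * product xs      ≡⟨ xy∙z≈xz∙y c (product ys) (product xs) ⟩
  c * product xs * product ys      ∎)
  where open ≤-Reasoning

^length*product-filter≤ : ∀ B xs →
  B ^ length xs * product (filter (_≤? B) xs) ≤ B ^ length (filter (_≤? B) xs) * product xs
^length*product-filter≤ B [] = ≤-refl
^length*product-filter≤ B (x ∷ xs) with x ≤? B
... | yes x≤B rewrite filter-accept (_≤? B) {xs = xs} x≤B =
  interchange-mono-≤ B x (^length*product-filter≤ B xs)
... | no x≰B rewrite filter-reject (_≤? B) {xs = xs} x≰B = begin
  B * B ^ length xs * product small   ≡⟨ *-assoc B _ _ ⟩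
  B * (B ^ length xs * product small) ≤⟨ *-mono-≤ (<⇒≤ (≰⇒> x≰B)) (^length*product-filter≤ B xs) ⟩
  x * (B ^ length small * product xs) ≡⟨ x∙yz≈y∙xz x (B ^ length small) (product xs) ⟩
  B ^ length small * (x * product xs) ∎
  where
  open ≤-Reasoning
  small = filter (_≤? B) xs

∈-tail : ∀ {y z} {ys : List ℕ} → y < z → z ∈ y ∷ ys → z ∈ ys
∈-tail y<y (here refl) = ⊥-elim (<-irrefl refl y<y)
∈-tail _   (there z∈ys) = z∈ys

All∈-tail : ∀ {y} {ys zs : List ℕ} → All (y <_) zs → All (_∈ y ∷ ys) zs → All (_∈ ys) zs
All∈-tail y<zs zs∈ = All.zipWith (λ (y<z , z∈) → ∈-tail y<z z∈) (y<zs , zs∈)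

strictlyIncreasing-⊆ : ∀ {xs ys : List ℕ} → AllPairs _<_ xs → AllPairs _<_ ys →
                       All (_∈ ys) xs → xs ⊆ ys
strictlyIncreasing-⊆ {[]} _ _ _ = minimum _
strictlyIncreasing-⊆ {_ ∷ _} {[]} _ _ (() ∷ _)
strictlyIncreasing-⊆ {x ∷ _} {y ∷ _} (x<xs ∷ xs↑) (_ ∷ ys↑) (here refl ∷ xs∈) =
  refl ∷ strictlyIncreasing-⊆ xs↑ ys↑ (All∈-tail x<xs xs∈)
strictlyIncreasing-⊆ {x ∷ _} {y ∷ _} (x<xs ∷ xs↑) (y<ys ∷ ys↑) (there x∈ys ∷ xs∈) =
  y ∷ʳ strictlyIncreasing-⊆ (x<xs ∷ xs↑) ys↑ (x∈ys ∷ All∈-tail y<xs xs∈)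
  where
  y<x = All.lookup y<ys x∈ys
  y<xs = All.map (<-trans y<x) x<xs

upTo-strictlyIncreasing : ∀ n → AllPairs _<_ (upTo n)
upTo-strictlyIncreasing n = AllPairs.applyUpTo⁺₁ (λ i → i) n (λ i<j _ → i<j)

product-∣ : ∀ {n ps} → AllPairs _<_ ps → All Prime ps → All (_∣ n) ps → product ps ∣ n
product-∣ [] [] [] = 1∣ _
product-∣ {n} {p ∷ ps} (p<ps ∷ ps↑) (p-prime ∷ ps-prime) (p∣n ∷ ps∣n)
  with product-∣ ps↑ ps-prime ps∣n
... | divides q n≡q*Πps with euclidsLemma q (product ps) p-prime (subst (p ∣_) n≡q*Πps p∣n)
...   | inj₁ p∣q  = subst (p * product ps ∣_) (sym n≡q*Πps) (*-monoˡ-∣ (product ps) p∣q)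
...   | inj₂ p∣Πps =
  ⊥-elim (<-irrefl refl (All.lookup p<ps (factorisationHasAllPrimeFactors p-prime p∣Πps ps-prime)))

primeDivisors-strictlyIncreasing : ∀ t → AllPairs _<_ (primeDivisors t)
primeDivisors-strictlyIncreasing t =
  AllPairs.filter⁺ (λ p → prime? p ×-dec p ∣? t) (upTo-strictlyIncreasing (suc t))

∈-primeDivisors⁻ : ∀ t {p} → p ∈ primeDivisors t → Prime p × p ∣ t
∈-primeDivisors⁻ t p∈ = proj₂ (∈-filter⁻ (λ p → prime? p ×-dec p ∣? t) {xs = upTo (suc t)} p∈)

∈-smallPrimeDivisors⁻ : ∀ ℓ {t p} → p ∈ smallPrimeDivisors ℓ t → (Prime p × p ∣ t) × p ≤ 2 ^ ℓ
∈-smallPrimeDivisors⁻ ℓ {t} p∈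
  with p∈pd , p≤2^ℓ ← ∈-filter⁻ (_≤? 2 ^ ℓ) {xs = primeDivisors t} p∈ =
  ∈-primeDivisors⁻ t p∈pd , p≤2^ℓ

W-bound : ∀ ℓ {t} → 0 < t → WBound ℓ t
W-bound ℓ {t} t>0 = begin
  W t ^ ℓ * PSmall ℓ t
    ≡⟨ cong (_* PSmall ℓ t) W^ℓ≡[2^ℓ]^ν ⟩
  (2 ^ ℓ) ^ ν t * PSmall ℓ t
    ≤⟨ ^length*product-filter≤ (2 ^ ℓ) (primeDivisors t) ⟩
  (2 ^ ℓ) ^ jSmall ℓ t * product (primeDivisors t)
    ≤⟨ *-monoʳ-≤ ((2 ^ ℓ) ^ jSmall ℓ t) (∣⇒≤ {{>-nonZero t>0}} Πpd∣t) ⟩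
  (2 ^ ℓ) ^ jSmall ℓ t * t
    ≡⟨ cong (_* t) (m^[n*o]≡[m^o]^n 2 (jSmall ℓ t) ℓ) ⟨
  2 ^ (jSmall ℓ t * ℓ) * t
    ∎
  where
  open ≤-Reasoning
  W^ℓ≡[2^ℓ]^ν : W t ^ ℓ ≡ (2 ^ ℓ) ^ ν t
  W^ℓ≡[2^ℓ]^ν = trans (^-*-assoc 2 (ν t) ℓ) (m^[n*o]≡[m^o]^n 2 (ν t) ℓ)
  Πpd∣t : product (primeDivisors t) ∣ t
  Πpd∣t = product-∣ (primeDivisors-strictlyIncreasing t)
                    (All.tabulate (proj₁ ∘ ∈-primeDivisors⁻ t))
                    (All.tabulate (proj₂ ∘ ∈-primeDivisors⁻ t))

cLt-from-candidates : ∀ ℓ t num den {q} {Q : Pred ℕ q} (Q? : Decidable Q) →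
  (∀ {p} → Prime p → p ∣ t → Q p) →
  den ^ ℓ * (2 ^ ℓ) ^ length (filter Q? (upTo (suc (2 ^ ℓ))))
    < num ^ ℓ * product (filter Q? (upTo (suc (2 ^ ℓ)))) →
  cLt ℓ t num den
cLt-from-candidates ℓ t num den Q? prime-divisor⇒Q worst-case =
  subst (λ k → den ^ ℓ * k < num ^ ℓ * PSmall ℓ t) (sym (m^[n*o]≡[m^o]^n 2 (jSmall ℓ t) ℓ))
    (^length*product-⊆-< {a = den ^ ℓ} {c = num ^ ℓ} small⊆candidates candidates≤2^ℓ
      {{productOfPrimes≢0 (All.map proj₁ small-prime)}} worst-case)
  where
  candidates = filter Q? (upTo (suc (2 ^ ℓ)))

  small-prime : All (λ p → Prime p × p ∣ t) (smallPrimeDivisors ℓ t)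
  small-prime = All.tabulate (proj₁ ∘ ∈-smallPrimeDivisors⁻ ℓ)

  candidates≤2^ℓ : All (_≤ 2 ^ ℓ) candidates
  candidates≤2^ℓ = All.tabulate λ p∈ →
    ≤-pred (∈-upTo⁻ (proj₁ (∈-filter⁻ Q? {xs = upTo (suc (2 ^ ℓ))} p∈)))

  small⊆candidates : smallPrimeDivisors ℓ t ⊆ candidates
  small⊆candidates = strictlyIncreasing-⊆
    (AllPairs.filter⁺ (_≤? 2 ^ ℓ) (primeDivisors-strictlyIncreasing t))
    (AllPairs.filter⁺ Q? (upTo-strictlyIncreasing (suc (2 ^ ℓ))))
    (All.tabulate λ p∈ → let ((p-prime , p∣t) , p≤2^ℓ) = ∈-smallPrimeDivisors⁻ ℓ p∈ in
      ∈-filter⁺ Q? (∈-upTo⁺ (s≤s p≤2^ℓ)) (prime-divisor⇒Q p-prime p∣t))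

OddPrime : Pred ℕ _
OddPrime p = Prime p × ¬ 2 ∣ p

oddPrime? : Decidable OddPrime
oddPrime? p = prime? p ×-dec ¬? (2 ∣? p)

lemma7p1 : ((t ℓ : ℕ) → 0 < t → 0 < ℓ → WBound ℓ t)
         × ((t : ℕ) → 0 < t → cLt 4 t 487 100)
         × ((t : ℕ) → 0 < t → ¬ (2 ∣ t) → cLt 4 t 29 10)
         × ((t : ℕ) → 0 < t → cLt 6 t 46103 1000)
lemma7p1 =
    (λ t ℓ t>0 _ → W-bound ℓ t>0)
  , (λ t _ → cLt-from-candidates 4 t 487 100 prime? (λ p-prime _ → p-prime)
               (toWitness {a? = _ <? _} _))
  , (λ t _ 2∤t → cLt-from-candidates 4 t 29 10 oddPrime?
                   (λ p-prime p∣t → p-prime , λ 2∣p → 2∤t (∣-trans 2∣p p∣t))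
                   (toWitness {a? = _ <? _} _))
  , (λ t _ → cLt-from-candidates 6 t 46103 1000 prime? (λ p-prime _ → p-prime)
               (toWitness {a? = _ <? _} _))
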